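{- As formal power series in $z,t$, $$\sum_{m\ge0}\sum_{k\ge0}T_{10\times m}(5,k)z^mt^k=\frac{1-z^3t-z^4t-2z^5t^2-z^6t^2+z^8t^3+z^{10}t^4}{D(z,t)},$$ where $$\begin{aligned}D(z,t)={}&1-z-z^3t-5z^5t-3z^5t^2-z^6t^2-z^7t^2+4z^8t^2+2z^8t^3+4z^9t^2+2z^9t^3\\&+8z^{10}t^3+3z^{10}t^4+4z^{11}t^3+2z^{11}t^4-4z^{13}t^4-z^{13}t^5-4z^{15}t^5-z^{15}t^6.\end{aligned}$$
   Context: $T_{n\times m}(s,k)$ denotes the number of tilings of an $n\times m$ rectangle (width $n$, length $m$, unit grid) by exactly $k$ non-overlapping grid-aligned $s\times s$ squares and $nm-ks^2$ unit squares, with rotations/reflections counted as distinct; for $m=0$ the only tiling is the empty one with $k=0$. -}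

module Defs where

open import Data.Nat using (ℕ; zero; suc; _+_; _∸_; _≤ᵇ_; _≡ᵇ_)
open import Data.Bool using (Bool; true; false; _∧_; _∨_; if_then_else_)
open import Data.Product using (_×_; _,_)
open import Data.List using (List; []; _∷_; _++_; map; filterᵇ; length; upTo; cartesianProduct; foldr)
open import Data.Integer using (ℤ; +_; -[1+_]) renaming (_+_ to _+ℤ_; _*_ to _*ℤ_)

-- A tiling is determined by the set of placements of its s×s squares
-- (the unit squares fill the remaining cells uniquely).  A placement is
-- the lower-left corner (i , j) of an s×s square with i + s ≤ n
-- (width direction) and j + s ≤ m (length direction).

Pos : Set
Pos = ℕ × ℕ

placements : ℕ → ℕ → ℕ → List Pos
placements n m s =
  filterᵇ (λ { (i , j) → ((i + s) ≤ᵇ n) ∧ ((j + s) ≤ᵇ m) })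
          (cartesianProduct (upTo n) (upTo m))

disjointᵇ : ℕ → Pos → Pos → Bool
disjointᵇ s (i , j) (i' , j') =
  ((i + s) ≤ᵇ i') ∨ ((i' + s) ≤ᵇ i) ∨ ((j + s) ≤ᵇ j') ∨ ((j' + s) ≤ᵇ j)

allDisjointᵇ : ℕ → Pos → List Pos → Bool
allDisjointᵇ s p [] = true
allDisjointᵇ s p (q ∷ qs) = disjointᵇ s p q ∧ allDisjointᵇ s p qs

pairwiseDisjointᵇ : ℕ → List Pos → Bool
pairwiseDisjointᵇ s [] = true
pairwiseDisjointᵇ s (p ∷ ps) = allDisjointᵇ s p ps ∧ pairwiseDisjointᵇ s ps

subsets : {A : Set} → List A → List (List A)
subsets [] = [] ∷ []
subsets (x ∷ xs) = subsets xs ++ map (x ∷_) (subsets xs)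

T : ℕ → ℕ → ℕ → ℕ → ℕ
T n m s k =
  length (filterᵇ (λ S → (length S ≡ᵇ k) ∧ pairwiseDisjointᵇ s S)
                  (subsets (placements n m s)))

-- Formal power series in two variables z, t with integer coefficients:
-- f m k is the coefficient of z^m t^k.

FPS₂ : Set
FPS₂ = ℕ → ℕ → ℤ

sumTo : ℕ → (ℕ → ℤ) → ℤ
sumTo zero f = f zero
sumTo (suc n) f = sumTo n f +ℤ f (suc n)

_⋆_ : FPS₂ → FPS₂ → FPS₂
(f ⋆ g) m k = sumTo m (λ i → sumTo k (λ j → f i j *ℤ g (m ∸ i) (k ∸ j)))

-- a polynomial given as a list of monomials  c · z^a t^b  (c , a , b)
Monomial : Set
Monomial = ℤ × ℕ × ℕ

poly : List Monomial → FPS₂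
poly ts m k =
  foldr (λ { (c , a , b) acc → (if (a ≡ᵇ m) ∧ (b ≡ᵇ k) then c else + 0) +ℤ acc })
        (+ 0) ts

genT : ℕ → ℕ → FPS₂
genT n s m k = + (T n m s k)

numer : List Monomial
numer =
  (+ 1 , 0 , 0) ∷ (-[1+ 0 ] , 3 , 1) ∷ (-[1+ 0 ] , 4 , 1) ∷ (-[1+ 1 ] , 5 , 2) ∷
  (-[1+ 0 ] , 6 , 2) ∷ (+ 1 , 8 , 3) ∷ (+ 1 , 10 , 4) ∷ []

denom : List Monomial
denom =
  (+ 1 , 0 , 0) ∷ (-[1+ 0 ] , 1 , 0) ∷ (-[1+ 0 ] , 3 , 1) ∷ (-[1+ 4 ] , 5 , 1) ∷
  (-[1+ 2 ] , 5 , 2) ∷ (-[1+ 0 ] , 6 , 2) ∷ (-[1+ 0 ] , 7 , 2) ∷ (+ 4 , 8 , 2) ∷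
  (+ 2 , 8 , 3) ∷ (+ 4 , 9 , 2) ∷ (+ 2 , 9 , 3) ∷ (+ 8 , 10 , 3) ∷
  (+ 3 , 10 , 4) ∷ (+ 4 , 11 , 3) ∷ (+ 2 , 11 , 4) ∷ (-[1+ 3 ] , 13 , 4) ∷
  (-[1+ 0 ] , 13 , 5) ∷ (-[1+ 3 ] , 15 , 5) ∷ (-[1+ 0 ] , 15 , 6) ∷ []

module Submission where

-- A tiling is determined by the corners of its 5×5 squares.  Deciding the possible corners of
-- the 10 × m rectangle one at a time from its far end, the corners still undecided always form
-- one of fourteen staircase profiles, so the generating functions G_p(z,t) of the profiles
-- satisfy a linear system with monomial coefficients, whose solution has denominator D(z,t).
-- Instead of solving the system: the zⁿ-coefficients of D·G_p obey the same recurrences as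
-- those of G_p once n ≥ 16, and they vanish for five consecutive n (a finite computation by
-- dynamic programming), hence for all n ≥ 16.  The finitely many remaining coefficients of
-- D·G_{P0} are computed.

open import Defs
open import Algebra.Bundles using (CommutativeMonoid)
import Algebra.Properties.CommutativeSemigroup as CommSemigroupProperties
open import Data.Nat using (ℕ; zero; suc; _+_; _∸_; _≤_; _<_; _≤ᵇ_; _<ᵇ_; _≡ᵇ_; _⊓_; NonZero; >-nonZero⁻¹; s≤s; s≤s⁻¹)
import Data.Nat.Properties as ℕ
open import Data.Bool using (Bool; true; false; _∧_; _∨_; if_then_else_) renaming (T to True)
import Data.Bool.Properties as 𝔹
open import Data.Sum using (inj₁; inj₂)
open import Data.Product using (Σ-syntax; _×_; _,_; proj₁; proj₂)
open import Data.List using (List; []; _∷_; _++_; map; concatMap; filterᵇ; length; upTo; cartesianProduct)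
open import Data.Bool.ListAction using (all)
import Data.List.Properties as List
import Data.List.Relation.Unary.All as All
open import Data.List.Relation.Unary.All.Properties using (all⁺)
open import Data.List.Membership.Propositional.Properties using (∈-upTo⁺)
open import Data.List.Relation.Binary.Permutation.Propositional as ↭ using (_↭_)
open import Data.List.Relation.Binary.Permutation.Propositional.Properties using (↭-length) renaming (shift to ↭-shift)
open import Data.Integer using (ℤ; +_; -_) renaming (_+_ to _+ℤ_; _-_ to _-ℤ_; _*_ to _*ℤ_)
import Data.Integer.Properties as ℤ
open import Function using (_∘_; _⇔_; mk⇔; Equivalence)
open import Relation.Binary.PropositionalEquality using (_≡_; refl; sym; trans; cong; cong₂; subst; module ≡-Reasoning)
open import Relation.Nullary.Decidable using (yes; no; T?; isYes; toWitness)
open import Relation.Nullary.Negation using (contradiction)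

open CommSemigroupProperties ℕ.+-commutativeSemigroup using ()
  renaming (interchange to +-interchange)
open CommSemigroupProperties ℤ.+-commutativeSemigroup using ()
  renaming (interchange to +ℤ-interchange)
open CommSemigroupProperties (CommutativeMonoid.commutativeSemigroup 𝔹.∧-commutativeMonoid) using ()
  renaming (interchange to ∧-interchange; x∙yz≈y∙xz to ∧-left-comm)
open CommSemigroupProperties (CommutativeMonoid.commutativeSemigroup 𝔹.∨-commutativeMonoid) using ()
  renaming (x∙yz≈y∙xz to ∨-left-comm)

-- Counting subsets

private variable A B : Set

count : (A → Bool) → List A → ℕ
count P xs = length (filterᵇ P xs)

count-++ : (P : A → Bool) (xs ys : List A) → count P (xs ++ ys) ≡ count P xs + count P ys
count-++ P xs ys = trans (cong length (List.filter-++ (T? ∘ P) xs ys)) (List.length-++ (filterᵇ P xs))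

filterᵇ-map : (P : B → Bool) (f : A → B) (xs : List A) → filterᵇ P (map f xs) ≡ map f (filterᵇ (P ∘ f) xs)
filterᵇ-map P f [] = refl
filterᵇ-map P f (x ∷ xs) with P (f x)
... | true = cong (f x ∷_) (filterᵇ-map P f xs)
... | false = filterᵇ-map P f xs

count-map : (P : B → Bool) (f : A → B) (xs : List A) → count P (map f xs) ≡ count (P ∘ f) xs
count-map P f xs = trans (cong length (filterᵇ-map P f xs)) (List.length-map f (filterᵇ (P ∘ f) xs))

filterᵇ-cong : {P Q : A → Bool} → (∀ x → P x ≡ Q x) → (xs : List A) → filterᵇ P xs ≡ filterᵇ Q xs
filterᵇ-cong {P = P} {Q = Q} P≗Q =
  List.filter-≐ (T? ∘ P) (T? ∘ Q) ((λ {x} → subst True (P≗Q x)) , (λ {x} → subst True (sym (P≗Q x))))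

count-cong : {P Q : A → Bool} → (∀ x → P x ≡ Q x) → (xs : List A) → count P xs ≡ count Q xs
count-cong P≗Q xs = cong length (filterᵇ-cong P≗Q xs)

count-none : {P : A → Bool} → (∀ x → P x ≡ false) → (xs : List A) → count P xs ≡ 0
count-none P≗false [] = refl
count-none P≗false (x ∷ xs) rewrite P≗false x = count-none P≗false xs

count-subsets-∷ : (P : List A → Bool) (x : A) (xs : List A) →
  count P (subsets (x ∷ xs)) ≡ count P (subsets xs) + count (P ∘ (x ∷_)) (subsets xs)
count-subsets-∷ P x xs = trans (count-++ P (subsets xs) _) (cong (λ c → count P (subsets xs) + c) (count-map P (x ∷_) (subsets xs)))

Respects↭ : (List A → Bool) → Set
Respects↭ P = ∀ {S S'} → S ↭ S' → P S ≡ P S'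

count-subsets-↭ : {xs ys : List A} → xs ↭ ys → (P : List A → Bool) → Respects↭ P →
  count P (subsets xs) ≡ count P (subsets ys)
count-subsets-↭ ↭.refl P resp = refl
count-subsets-↭ {xs = x ∷ xs} {ys = x ∷ ys} (↭.prep x p) P resp =
  begin
    count P (subsets (x ∷ xs))                                ≡⟨ count-subsets-∷ P x xs ⟩
    count P (subsets xs) + count (P ∘ (x ∷_)) (subsets xs)    ≡⟨ cong₂ _+_ (count-subsets-↭ p P resp)
                                                                           (count-subsets-↭ p (P ∘ (x ∷_)) (resp ∘ ↭.prep x)) ⟩
    count P (subsets ys) + count (P ∘ (x ∷_)) (subsets ys)    ≡⟨ sym (count-subsets-∷ P x ys) ⟩
    count P (subsets (x ∷ ys))                                ∎
  where open ≡-Reasoning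
count-subsets-↭ {A = A} {xs = x ∷ y ∷ xs} {ys = y ∷ x ∷ ys} (↭.swap x y p) P resp =
  begin
    count P (subsets (x ∷ y ∷ xs))                         ≡⟨ expand x y xs ⟩
    (none xs + with-y xs) + (with-x xs + with-xy xs)       ≡⟨ +-interchange (none xs) (with-y xs) (with-x xs) (with-xy xs) ⟩
    (none xs + with-x xs) + (with-y xs + with-xy xs)       ≡⟨ cong₂ _+_ (cong₂ _+_ (IH P resp) (IH (P ∘ (x ∷_)) (resp ∘ ↭.prep x)))
                                                                        (cong₂ _+_ (IH (P ∘ (y ∷_)) (resp ∘ ↭.prep y)) with-both) ⟩
    (none ys + with-x ys) + (with-y ys + with-yx ys)       ≡⟨ expand y x ys ⟨
    count P (subsets (y ∷ x ∷ ys))                         ∎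
  where
  open ≡-Reasoning
  none with-x with-y with-xy with-yx : List A → ℕ
  none zs = count P (subsets zs)
  with-x zs = count (P ∘ (x ∷_)) (subsets zs)
  with-y zs = count (P ∘ (y ∷_)) (subsets zs)
  with-xy zs = count (P ∘ (x ∷_) ∘ (y ∷_)) (subsets zs)
  with-yx zs = count (P ∘ (y ∷_) ∘ (x ∷_)) (subsets zs)
  IH : (Q : List A → Bool) → Respects↭ Q → count Q (subsets xs) ≡ count Q (subsets ys)
  IH = count-subsets-↭ p
  with-both : with-xy xs ≡ with-yx ys
  with-both = trans (IH (P ∘ (x ∷_) ∘ (y ∷_)) (resp ∘ ↭.prep x ∘ ↭.prep y))
                    (count-cong (λ S → resp (↭.swap x y ↭.refl)) (subsets ys))
  expand : ∀ u v zs → count P (subsets (u ∷ v ∷ zs)) ≡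
      (count P (subsets zs) + count (P ∘ (v ∷_)) (subsets zs))
    + (count (P ∘ (u ∷_)) (subsets zs) + count (P ∘ (u ∷_) ∘ (v ∷_)) (subsets zs))
  expand u v zs = trans (count-subsets-∷ P u (v ∷ zs)) (cong₂ _+_ (count-subsets-∷ P v zs) (count-subsets-∷ (P ∘ (u ∷_)) v zs))
count-subsets-↭ (↭.trans p q) P resp = trans (count-subsets-↭ p P resp) (count-subsets-↭ q P resp)

-- Packings of s×s squares

disjointᵇ-sym : ∀ s p q → disjointᵇ s p q ≡ disjointᵇ s q p
disjointᵇ-sym s (i , j) (i' , j') =
  trans (∨-left-comm (i + s ≤ᵇ i') (i' + s ≤ᵇ i) _)
        (cong (λ b → (i' + s ≤ᵇ i) ∨ ((i + s ≤ᵇ i') ∨ b)) (𝔹.∨-comm (j + s ≤ᵇ j') (j' + s ≤ᵇ j)))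

allDisjointᵇ-↭ : ∀ s p {S S'} → S ↭ S' → allDisjointᵇ s p S ≡ allDisjointᵇ s p S'
allDisjointᵇ-↭ s p ↭.refl = refl
allDisjointᵇ-↭ s p (↭.prep q ρ) = cong (disjointᵇ s p q ∧_) (allDisjointᵇ-↭ s p ρ)
allDisjointᵇ-↭ s p {S' = r ∷ q ∷ S'} (↭.swap q r ρ) =
  trans (cong (λ b → disjointᵇ s p q ∧ (disjointᵇ s p r ∧ b)) (allDisjointᵇ-↭ s p ρ))
        (∧-left-comm (disjointᵇ s p q) (disjointᵇ s p r) (allDisjointᵇ s p S'))
allDisjointᵇ-↭ s p (↭.trans ρ σ) = trans (allDisjointᵇ-↭ s p ρ) (allDisjointᵇ-↭ s p σ)

pairwiseDisjointᵇ-↭ : ∀ s → Respects↭ (pairwiseDisjointᵇ s)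
pairwiseDisjointᵇ-↭ s ↭.refl = refl
pairwiseDisjointᵇ-↭ s (↭.prep p ρ) = cong₂ _∧_ (allDisjointᵇ-↭ s p ρ) (pairwiseDisjointᵇ-↭ s ρ)
pairwiseDisjointᵇ-↭ s {p ∷ q ∷ S} {q ∷ p ∷ S'} (↭.swap p q ρ) =
  begin
    (disjointᵇ s p q ∧ allDisjointᵇ s p S) ∧ (allDisjointᵇ s q S ∧ pairwiseDisjointᵇ s S)
      ≡⟨ cong₂ _∧_ (cong₂ _∧_ (disjointᵇ-sym s p q) (allDisjointᵇ-↭ s p ρ))
                   (cong₂ _∧_ (allDisjointᵇ-↭ s q ρ) (pairwiseDisjointᵇ-↭ s ρ)) ⟩
    (disjointᵇ s q p ∧ allDisjointᵇ s p S') ∧ (allDisjointᵇ s q S' ∧ pairwiseDisjointᵇ s S')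
      ≡⟨ ∧-interchange (disjointᵇ s q p) (allDisjointᵇ s p S') (allDisjointᵇ s q S') (pairwiseDisjointᵇ s S') ⟩
    (disjointᵇ s q p ∧ allDisjointᵇ s q S') ∧ (allDisjointᵇ s p S' ∧ pairwiseDisjointᵇ s S') ∎
  where open ≡-Reasoning
pairwiseDisjointᵇ-↭ s (↭.trans ρ σ) = trans (pairwiseDisjointᵇ-↭ s ρ) (pairwiseDisjointᵇ-↭ s σ)

isPackingᵇ : ℕ → ℕ → List Pos → Bool
isPackingᵇ s k S = (length S ≡ᵇ k) ∧ pairwiseDisjointᵇ s S

packings : ℕ → List Pos → ℕ → ℕ
packings s L k = count (isPackingᵇ s k) (subsets L)

packings-↭ : ∀ s {L L'} → L ↭ L' → ∀ k → packings s L k ≡ packings s L' k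
packings-↭ s ρ k =
  count-subsets-↭ ρ (isPackingᵇ s k) (λ σ → cong₂ (λ n b → (n ≡ᵇ k) ∧ b) (↭-length σ) (pairwiseDisjointᵇ-↭ s σ))

packings-zero : ∀ s L → packings s L 0 ≡ 1
packings-zero s [] = refl
packings-zero s (p ∷ L) =
  trans (count-subsets-∷ (isPackingᵇ s 0) p L) (cong₂ _+_ (packings-zero s L) (count-none (λ _ → refl) (subsets L)))

count-subsets-filterᵇ : (P : List A → Bool) (Q : A → Bool) (L : List A) →
  count (λ S → P S ∧ all Q S) (subsets L) ≡ count P (subsets (filterᵇ Q L))
count-subsets-filterᵇ P Q [] with P []
... | true = refl
... | false = refl
count-subsets-filterᵇ P Q (q ∷ L) with Q q in Qq
... | true =
  trans (count-subsets-∷ (λ S → P S ∧ all Q S) q L)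
        (trans (cong₂ _+_ (count-subsets-filterᵇ P Q L)
                          (trans (count-cong (λ S → cong (λ b → P (q ∷ S) ∧ (b ∧ all Q S)) Qq) (subsets L))
                                 (count-subsets-filterᵇ (P ∘ (q ∷_)) Q L)))
               (sym (count-subsets-∷ P q (filterᵇ Q L))))
... | false =
  trans (count-subsets-∷ (λ S → P S ∧ all Q S) q L)
        (trans (cong₂ _+_ (count-subsets-filterᵇ P Q L)
                          (count-none (λ S → trans (cong (λ b → P (q ∷ S) ∧ (b ∧ all Q S)) Qq) (𝔹.∧-zeroʳ (P (q ∷ S))))
                                      (subsets L)))
               (ℕ.+-identityʳ (count P (subsets (filterᵇ Q L)))))

allDisjointᵇ≡all : ∀ s p S → allDisjointᵇ s p S ≡ all (disjointᵇ s p) S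
allDisjointᵇ≡all s p [] = refl
allDisjointᵇ≡all s p (q ∷ S) = cong (disjointᵇ s p q ∧_) (allDisjointᵇ≡all s p S)

-- A packing either avoids the first corner p, or contains p and then its other squares avoid p.
packings-∷ : ∀ s p L k → packings s (p ∷ L) (suc k) ≡ packings s L (suc k) + packings s (filterᵇ (disjointᵇ s p) L) k
packings-∷ s p L k =
  trans (count-subsets-∷ (isPackingᵇ s (suc k)) p L)
        (cong (λ c → packings s L (suc k) + c)
              (trans (count-cong rearrange (subsets L)) (count-subsets-filterᵇ (isPackingᵇ s k) (disjointᵇ s p) L)))
  where
  rearrange : ∀ S → isPackingᵇ s (suc k) (p ∷ S) ≡ isPackingᵇ s k S ∧ all (disjointᵇ s p) S
  rearrange S = begin
    (length S ≡ᵇ k) ∧ (allDisjointᵇ s p S ∧ pairwiseDisjointᵇ s S)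
      ≡⟨ cong ((length S ≡ᵇ k) ∧_) (𝔹.∧-comm (allDisjointᵇ s p S) (pairwiseDisjointᵇ s S)) ⟩
    (length S ≡ᵇ k) ∧ (pairwiseDisjointᵇ s S ∧ allDisjointᵇ s p S)
      ≡⟨ 𝔹.∧-assoc (length S ≡ᵇ k) (pairwiseDisjointᵇ s S) (allDisjointᵇ s p S) ⟨
    isPackingᵇ s k S ∧ allDisjointᵇ s p S                           ≡⟨ cong (isPackingᵇ s k S ∧_) (allDisjointᵇ≡all s p S) ⟩
    isPackingᵇ s k S ∧ all (disjointᵇ s p) S                        ∎
    where open ≡-Reasoning

-- Staircases of corner rows

row : ℕ → ℕ → List Pos
row i a = map (i ,_) (upTo a)

rowsFrom : ℕ → ℕ → List ℕ → List Pos
rowsFrom i n [] = []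
rowsFrom i n (d ∷ ds) = row i (n ∸ d) ++ rowsFrom (suc i) n ds

rowsFrom-++ : ∀ i n ds es → rowsFrom i n (ds ++ es) ≡ rowsFrom i n ds ++ rowsFrom (length ds + i) n es
rowsFrom-++ i n [] es = refl
rowsFrom-++ i n (d ∷ ds) es =
  trans (cong (row i (n ∸ d) ++_) (trans (rowsFrom-++ (suc i) n ds es)
                                         (cong (λ j → rowsFrom (suc i) n ds ++ rowsFrom j n es) (ℕ.+-suc (length ds) i))))
        (sym (List.++-assoc (row i (n ∸ d)) _ _))

rowsFrom-lag : ∀ i n l ds → rowsFrom i n (map (λ d → l + d) ds) ≡ rowsFrom i (n ∸ l) ds
rowsFrom-lag i n l [] = refl
rowsFrom-lag i n l (d ∷ ds) = cong₂ (λ a R → row i a ++ R) (sym (ℕ.∸-+-assoc n l d)) (rowsFrom-lag (suc i) n l ds)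

rowsFrom-empty : ∀ i ds → rowsFrom i 0 ds ≡ []
rowsFrom-empty i [] = refl
rowsFrom-empty i (d ∷ ds) rewrite ℕ.0∸n≡0 d = rowsFrom-empty (suc i) ds

rowsFrom-↭ : ∀ i n pre post →
  rowsFrom i (suc n) (pre ++ 0 ∷ post) ↭ (length pre + i , n) ∷ rowsFrom i (suc n) (pre ++ 1 ∷ post)
rowsFrom-↭ i n pre post = begin
  rowsFrom i (suc n) (pre ++ 0 ∷ post)           ≡⟨ rowsFrom-++ i (suc n) pre (0 ∷ post) ⟩
  R ++ (row r (suc n) ++ R′)                       ≡⟨ cong (λ cs → R ++ (cs ++ R′)) row-suc ⟩
  R ++ ((row r n ++ (r , n) ∷ []) ++ R′)           ≡⟨ cong (R ++_) (List.++-assoc (row r n) _ R′) ⟩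
  R ++ (row r n ++ (r , n) ∷ R′)                   ≡⟨ List.++-assoc R (row r n) _ ⟨
  (R ++ row r n) ++ (r , n) ∷ R′                   ↭⟨ ↭-shift (r , n) (R ++ row r n) R′ ⟩
  (r , n) ∷ (R ++ row r n) ++ R′                   ≡⟨ cong ((r , n) ∷_) (List.++-assoc R (row r n) R′) ⟩
  (r , n) ∷ R ++ (row r n ++ R′)                   ≡⟨ cong ((r , n) ∷_) (rowsFrom-++ i (suc n) pre (1 ∷ post)) ⟨
  (r , n) ∷ rowsFrom i (suc n) (pre ++ 1 ∷ post)   ∎
  where
  open ↭.PermutationReasoning
  r : ℕ
  r = length pre + i
  R R′ : List Pos
  R = rowsFrom i (suc n) pre
  R′ = rowsFrom (suc r) (suc n) post
  row-suc : row r (suc n) ≡ row r n ++ (r , n) ∷ []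
  row-suc = trans (cong (map (r ,_)) (sym (List.upTo-∷ʳ n))) (List.map-++ (r ,_) (upTo n) (n ∷ []))

filterᵇ-true : (xs : List A) → filterᵇ (λ _ → true) xs ≡ xs
filterᵇ-true [] = refl
filterᵇ-true (x ∷ xs) = cong (x ∷_) (filterᵇ-true xs)

filterᵇ-none : (xs : List A) → filterᵇ (λ _ → false) xs ≡ []
filterᵇ-none [] = refl
filterᵇ-none (x ∷ xs) = filterᵇ-none xs

filterᵇ-upTo : (P : ℕ → Bool) (a b : ℕ) → (∀ j → j < a → True (P j) ⇔ j < b) → filterᵇ P (upTo a) ≡ upTo (a ⊓ b)
filterᵇ-upTo P zero b P⇔ = refl
filterᵇ-upTo P (suc a) b P⇔ = begin
  filterᵇ P (upTo (suc a))                   ≡⟨ cong (filterᵇ P) (List.upTo-∷ʳ a) ⟨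
  filterᵇ P (upTo a ++ a ∷ [])                ≡⟨ List.filter-++ (T? ∘ P) (upTo a) (a ∷ []) ⟩
  filterᵇ P (upTo a) ++ filterᵇ P (a ∷ [])
                                              ≡⟨ cong (_++ filterᵇ P (a ∷ [])) (filterᵇ-upTo P a b (λ j j<a → P⇔ j (ℕ.m<n⇒m<1+n j<a))) ⟩
  upTo (a ⊓ b) ++ filterᵇ P (a ∷ [])          ≡⟨ last-column (P a) refl ⟩
  upTo (suc a ⊓ b)                            ∎
  where
  open ≡-Reasoning
  last-column : ∀ v → P a ≡ v → upTo (a ⊓ b) ++ filterᵇ P (a ∷ []) ≡ upTo (suc a ⊓ b)
  last-column true Pa rewrite Pa = grow (Equivalence.to (P⇔ a (ℕ.n<1+n a)) (subst True (sym Pa) _))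
    where
    grow : a < b → upTo (a ⊓ b) ++ a ∷ [] ≡ upTo (suc a ⊓ b)
    grow a<b rewrite ℕ.m≤n⇒m⊓n≡m (ℕ.<⇒≤ a<b) | ℕ.m≤n⇒m⊓n≡m a<b = List.upTo-∷ʳ a
  last-column false Pa rewrite Pa = stay (ℕ.≮⇒≥ (λ a<b → subst True Pa (Equivalence.from (P⇔ a (ℕ.n<1+n a)) a<b)))
    where
    stay : b ≤ a → upTo (a ⊓ b) ++ [] ≡ upTo (suc a ⊓ b)
    stay b≤a rewrite ℕ.m≥n⇒m⊓n≡n b≤a | ℕ.m≥n⇒m⊓n≡n (ℕ.m≤n⇒m≤1+n b≤a) = List.++-identityʳ (upTo b)

+≤ᵇ⇔<∸ : ∀ j s n → True (j + s ≤ᵇ n) ⇔ j < suc n ∸ s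
+≤ᵇ⇔<∸ j s n = mk⇔ (λ le → ℕ.m+n≤o⇒m≤o∸n (suc j) (s≤s (ℕ.≤ᵇ⇒≤ (j + s) n le)))
                   (λ lt → ℕ.≤⇒≤ᵇ (s≤s⁻¹ (ℕ.m≤o∸n⇒m+n≤o (suc j) (s≤1+n lt) lt)))
  where
  s≤1+n : j < suc n ∸ s → s ≤ suc n
  s≤1+n lt = ℕ.<⇒≤ (ℕ.m∸n≢0⇒n<m (λ eq → contradiction (subst (suc j ≤_) eq lt) λ ()))

far : ℕ → ℕ → ℕ → Bool
far s r i = (r + s ≤ᵇ i) ∨ (i + s ≤ᵇ r)

afterPlacing : ℕ → ℕ → ℕ → List ℕ → List ℕ
afterPlacing s r i [] = []
afterPlacing s r i (d ∷ ds) = (if far s r i then d else s) ∷ afterPlacing s r (suc i) ds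

filter-row : ∀ s .{{_ : NonZero s}} r i n d → d ≤ s →
  filterᵇ (disjointᵇ s (r , n)) (row i (suc n ∸ d)) ≡ row i (suc n ∸ (if far s r i then d else s))
filter-row s r i n d d≤s =
  trans (filterᵇ-map (disjointᵇ s (r , n)) (i ,_) (upTo (suc n ∸ d)))
        (cong (map (i ,_)) (trans (filterᵇ-cong (λ j → sym (𝔹.∨-assoc (r + s ≤ᵇ i) (i + s ≤ᵇ r) _)) (upTo (suc n ∸ d)))
                                  (columns (far s r i))))
  where
  apart : ℕ → Bool
  apart j = (n + s ≤ᵇ j) ∨ (j + s ≤ᵇ n)
  apart⇔ : ∀ j → j < suc n ∸ d → True (apart j) ⇔ j < suc n ∸ s
  apart⇔ j j<a = mk⇔ to (Equivalence.from 𝔹.T-∨ ∘ inj₂ ∘ Equivalence.from (+≤ᵇ⇔<∸ j s n))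
    where
    to : True (apart j) → j < suc n ∸ s
    to t with Equivalence.to 𝔹.T-∨ t
    ... | inj₁ n+s≤j = contradiction (ℕ.≤-trans (ℕ.≤ᵇ⇒≤ (n + s) j n+s≤j)
                                                (s≤s⁻¹ (ℕ.≤-trans j<a (ℕ.m∸n≤m (suc n) d))))
                                     (ℕ.<⇒≱ (ℕ.m<m+n n (>-nonZero⁻¹ s)))
    ... | inj₂ j+s≤n = Equivalence.to (+≤ᵇ⇔<∸ j s n) j+s≤n
  columns : ∀ b → filterᵇ (λ j → b ∨ apart j) (upTo (suc n ∸ d)) ≡ upTo (suc n ∸ (if b then d else s))
  columns true = filterᵇ-true (upTo (suc n ∸ d))
  columns false = trans (filterᵇ-upTo apart (suc n ∸ d) (suc n ∸ s) apart⇔)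
                        (cong upTo (ℕ.m≥n⇒m⊓n≡n (ℕ.∸-monoʳ-≤ (suc n) d≤s)))

filter-rowsFrom : ∀ s .{{_ : NonZero s}} r i n ds → True (all (_≤ᵇ s) ds) →
  filterᵇ (disjointᵇ s (r , n)) (rowsFrom i (suc n) ds) ≡ rowsFrom i (suc n) (afterPlacing s r i ds)
filter-rowsFrom s r i n [] _ = refl
filter-rowsFrom s r i n (d ∷ ds) bounded =
  trans (List.filter-++ (T? ∘ disjointᵇ s (r , n)) (row i (suc n ∸ d)) (rowsFrom (suc i) (suc n) ds))
        (cong₂ _++_ (filter-row s r i n d (ℕ.≤ᵇ⇒≤ d s (proj₁ bounded′))) (filter-rowsFrom s r (suc i) n ds (proj₂ bounded′)))
  where
  bounded′ : True (d ≤ᵇ s) × True (all (_≤ᵇ s) ds)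
  bounded′ = Equivalence.to 𝔹.T-∧ bounded

-- The last cell of the row of deficit 0 either is no corner of the packing, or it is, and then
-- every row less than s away keeps only its corners at least s columns before it.
packings-rowsFrom : ∀ s .{{_ : NonZero s}} n pre post k → True (all (_≤ᵇ s) (pre ++ 1 ∷ post)) →
  packings s (rowsFrom 0 (suc n) (pre ++ 0 ∷ post)) (suc k) ≡
  packings s (rowsFrom 0 (suc n) (pre ++ 1 ∷ post)) (suc k)
    + packings s (rowsFrom 0 (suc n) (afterPlacing s (length pre + 0) 0 (pre ++ 1 ∷ post))) k
packings-rowsFrom s n pre post k bounded = begin
  packings s (rowsFrom 0 (suc n) (pre ++ 0 ∷ post)) (suc k)          ≡⟨ packings-↭ s (rowsFrom-↭ 0 n pre post) (suc k) ⟩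
  packings s ((r , n) ∷ R) (suc k)                                   ≡⟨ packings-∷ s (r , n) R k ⟩
  packings s R (suc k) + packings s (filterᵇ (disjointᵇ s (r , n)) R) k
    ≡⟨ cong (λ L → packings s R (suc k) + packings s L k) (filter-rowsFrom s r 0 n (pre ++ 1 ∷ post) bounded) ⟩
  packings s R (suc k) + packings s (rowsFrom 0 (suc n) (afterPlacing s r 0 (pre ++ 1 ∷ post))) k ∎
  where
  open ≡-Reasoning
  r : ℕ
  r = length pre + 0
  R : List Pos
  R = rowsFrom 0 (suc n) (pre ++ 1 ∷ post)

placementRow : ℕ → ℕ → ℕ → ℕ → List Pos
placementRow n m s i = if i + s ≤ᵇ n then row i (suc m ∸ s) else []

placements-rows : ∀ n m s .{{_ : NonZero s}} → placements n m s ≡ concatMap (placementRow n m s) (upTo n)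
placements-rows n m s = rows (upTo n)
  where
  fits : Pos → Bool
  fits (i , j) = ((i + s) ≤ᵇ n) ∧ ((j + s) ≤ᵇ m)
  columns : filterᵇ (λ j → j + s ≤ᵇ m) (upTo m) ≡ upTo (suc m ∸ s)
  columns = trans (filterᵇ-upTo _ m (suc m ∸ s) (λ j _ → +≤ᵇ⇔<∸ j s m))
                  (cong upTo (ℕ.m≥n⇒m⊓n≡n (ℕ.∸-monoʳ-≤ (suc m) (>-nonZero⁻¹ s))))
  one-row : ∀ i → filterᵇ fits (map (i ,_) (upTo m)) ≡ placementRow n m s i
  one-row i = trans (filterᵇ-map fits (i ,_) (upTo m)) (by-fit (i + s ≤ᵇ n))
    where
    by-fit : ∀ b → map (i ,_) (filterᵇ (λ j → b ∧ (j + s ≤ᵇ m)) (upTo m)) ≡ (if b then row i (suc m ∸ s) else [])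
    by-fit true = cong (map (i ,_)) columns
    by-fit false = cong (map (i ,_)) (filterᵇ-none (upTo m))
  rows : ∀ is → filterᵇ fits (cartesianProduct is (upTo m)) ≡ concatMap (placementRow n m s) is
  rows [] = refl
  rows (i ∷ is) = trans (List.filter-++ (T? ∘ fits) (map (i ,_) (upTo m)) _) (cong₂ _++_ (one-row i) (rows is))

-- The fourteen profiles of the strip of width 10

-- A profile is a deficit vector d₀ … d₅: corner row i offers its first n ∸ dᵢ columns, so the
-- zero vector at n gives the corners of the 10 × (n + 4) rectangle.  Deciding the last cell of
-- the first row of deficit 0 (where split cuts) leads from these fourteen vectors only to one
-- another, up to adding a lag to every entry.
data Profile : Set where
  P0 A1 A2 A3 A4 B1 B2 B3 B4 B5 C2 C3 C4 C5 : Profile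

split : Profile → List ℕ × List ℕ
split P0 = [] , 0 ∷ 0 ∷ 0 ∷ 0 ∷ 0 ∷ []
split A1 = [] , 1 ∷ 1 ∷ 1 ∷ 1 ∷ 1 ∷ []
split A2 = [] , 2 ∷ 2 ∷ 2 ∷ 2 ∷ 2 ∷ []
split A3 = [] , 3 ∷ 3 ∷ 3 ∷ 3 ∷ 3 ∷ []
split A4 = [] , 4 ∷ 4 ∷ 4 ∷ 4 ∷ 4 ∷ []
split B1 = 1 ∷ [] , 0 ∷ 0 ∷ 0 ∷ 0 ∷ []
split B2 = 1 ∷ 1 ∷ [] , 0 ∷ 0 ∷ 0 ∷ []
split B3 = 1 ∷ 1 ∷ 1 ∷ [] , 0 ∷ 0 ∷ []
split B4 = 1 ∷ 1 ∷ 1 ∷ 1 ∷ [] , 0 ∷ []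
split B5 = 1 ∷ 1 ∷ 1 ∷ 1 ∷ 1 ∷ [] , []
split C2 = 2 ∷ 2 ∷ 2 ∷ 2 ∷ 2 ∷ [] , []
split C3 = 3 ∷ 3 ∷ 3 ∷ 3 ∷ 3 ∷ [] , []
split C4 = 4 ∷ 4 ∷ 4 ∷ 4 ∷ 4 ∷ [] , []
split C5 = 5 ∷ 5 ∷ 5 ∷ 5 ∷ 5 ∷ [] , []

deficits : Profile → List ℕ
deficits p = proj₁ (split p) ++ 0 ∷ proj₂ (split p)

packs : Profile → ℕ → ℕ → ℕ
packs p n = packings 5 (rowsFrom 0 n (deficits p))

-- A profile together with a lag l, standing for that profile at length n ∸ l.
Successor : Set
Successor = Profile × ℕ

skip place : Profile → Successor
skip P0 = B1 , 0
skip A1 = P0 , 1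
skip A2 = A1 , 1
skip A3 = A2 , 1
skip A4 = A3 , 1
skip B1 = B2 , 0
skip B2 = B3 , 0
skip B3 = B4 , 0
skip B4 = B5 , 0
skip B5 = P0 , 1
skip C2 = B5 , 1
skip C3 = C2 , 1
skip C4 = C3 , 1
skip C5 = C4 , 1
place P0 = C5 , 0
place A1 = C4 , 1
place A2 = C3 , 2
place A3 = C2 , 3
place A4 = B5 , 4
place B1 = P0 , 5
place B2 = P0 , 5
place B3 = P0 , 5
place B4 = P0 , 5
place B5 = A4 , 1
place C2 = A3 , 2
place C3 = A2 , 3
place C4 = A1 , 4
place C5 = P0 , 5

shiftedDeficits : Successor → List ℕ
shiftedDeficits (q , l) = map (λ d → l + d) (deficits q)

skipped placed : Profile → List ℕ
skipped p = proj₁ (split p) ++ 1 ∷ proj₂ (split p)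
placed p = afterPlacing 5 (length (proj₁ (split p)) + 0) 0 (skipped p)

TransitionsValid : Profile → Set
TransitionsValid p =
  skipped p ≡ shiftedDeficits (skip p) × placed p ≡ shiftedDeficits (place p) × True (all (_≤ᵇ 5) (skipped p))

transitionsValid : ∀ p → TransitionsValid p
transitionsValid P0 = refl , refl , _
transitionsValid A1 = refl , refl , _
transitionsValid A2 = refl , refl , _
transitionsValid A3 = refl , refl , _
transitionsValid A4 = refl , refl , _
transitionsValid B1 = refl , refl , _
transitionsValid B2 = refl , refl , _
transitionsValid B3 = refl , refl , _
transitionsValid B4 = refl , refl , _
transitionsValid B5 = refl , refl , _
transitionsValid C2 = refl , refl , _
transitionsValid C3 = refl , refl , _
transitionsValid C4 = refl , refl , _
transitionsValid C5 = refl , refl , _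

packsAfter : Successor → ℕ → ℕ → ℕ
packsAfter σ n = packs (proj₁ σ) (n ∸ proj₂ σ)

packs-rowsFrom : ∀ σ n → packings 5 (rowsFrom 0 n (shiftedDeficits σ)) ≡ packsAfter σ n
packs-rowsFrom (q , l) n = cong (packings 5) (rowsFrom-lag 0 n l (deficits q))

packs-suc : ∀ p n k → packs p (suc n) (suc k) ≡ packsAfter (skip p) (suc n) (suc k) + packsAfter (place p) (suc n) k
packs-suc p n k with transitionsValid p
... | skip-valid , place-valid , bounded = begin
  packs p (suc n) (suc k)
    ≡⟨ packings-rowsFrom 5 n (proj₁ (split p)) (proj₂ (split p)) k bounded ⟩
  packings 5 (rowsFrom 0 (suc n) (skipped p)) (suc k) + packings 5 (rowsFrom 0 (suc n) (placed p)) k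
    ≡⟨ cong₂ (λ ds es → packings 5 (rowsFrom 0 (suc n) ds) (suc k) + packings 5 (rowsFrom 0 (suc n) es) k) skip-valid place-valid ⟩
  packings 5 (rowsFrom 0 (suc n) (shiftedDeficits (skip p))) (suc k) + packings 5 (rowsFrom 0 (suc n) (shiftedDeficits (place p))) k
    ≡⟨ cong₂ (λ f g → f (suc k) + g k) (packs-rowsFrom (skip p) (suc n)) (packs-rowsFrom (place p) (suc n)) ⟩
  packsAfter (skip p) (suc n) (suc k) + packsAfter (place p) (suc n) k ∎
  where open ≡-Reasoning

-- Generating polynomials in t

Series : Set
Series = ℕ → ℤ

shift : ℕ → Series → Series
shift zero f k = f k
shift (suc b) f zero = + 0
shift (suc b) f (suc k) = shift b f k

gen : Profile → ℕ → Series
gen p n k = + packs p n k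

genAfter : Successor → ℕ → Series
genAfter σ n = gen (proj₁ σ) (n ∸ proj₂ σ)

gen-suc : ∀ p n k → gen p (suc n) k ≡ genAfter (skip p) (suc n) k +ℤ shift 1 (genAfter (place p) (suc n)) k
gen-suc p n zero
  rewrite packings-zero 5 (rowsFrom 0 (suc n) (deficits p))
        | packings-zero 5 (rowsFrom 0 (suc n ∸ proj₂ (skip p)) (deficits (proj₁ (skip p)))) = refl
gen-suc p n (suc k) = trans (cong +_ (packs-suc p n k)) (ℤ.pos-+ (packsAfter (skip p) (suc n) (suc k)) (packsAfter (place p) (suc n) k))

shift-cong : ∀ b {f g : Series} → (∀ k → f k ≡ g k) → ∀ k → shift b f k ≡ shift b g k
shift-cong zero f≗g k = f≗g k
shift-cong (suc b) f≗g zero = refl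
shift-cong (suc b) f≗g (suc k) = shift-cong b f≗g k

shift-+ : ∀ b (f g : Series) k → shift b (λ i → f i +ℤ g i) k ≡ shift b f k +ℤ shift b g k
shift-+ zero f g k = refl
shift-+ (suc b) f g zero = refl
shift-+ (suc b) f g (suc k) = shift-+ b f g k

shift-* : ∀ b c (f : Series) k → shift b (λ i → c *ℤ f i) k ≡ c *ℤ shift b f k
shift-* zero c f k = refl
shift-* (suc b) c f zero = sym (ℤ.*-zeroʳ c)
shift-* (suc b) c f (suc k) = shift-* b c f k

shift-shift₁ : ∀ b (f : Series) k → shift b (shift 1 f) k ≡ shift 1 (shift b f) k
shift-shift₁ zero f k = refl
shift-shift₁ (suc b) f zero = refl
shift-shift₁ (suc b) f (suc zero) = shift-shift₁ b f zero
shift-shift₁ (suc b) f (suc (suc k)) = shift-shift₁ b f (suc k)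

-- Tables over the profiles: a level of the recursion is stored as data, so that its entries are
-- computed once and shared by all later levels.
record Table (F : Profile → Set) : Set where
  constructor table
  field
    at-P0 : F P0
    at-A1 : F A1
    at-A2 : F A2
    at-A3 : F A3
    at-A4 : F A4
    at-B1 : F B1
    at-B2 : F B2
    at-B3 : F B3
    at-B4 : F B4
    at-B5 : F B5
    at-C2 : F C2
    at-C3 : F C3
    at-C4 : F C4
    at-C5 : F C5

module _ {F : Profile → Set} where

  lookup : Table F → ∀ p → F p
  lookup t P0 = Table.at-P0 t
  lookup t A1 = Table.at-A1 t
  lookup t A2 = Table.at-A2 t
  lookup t A3 = Table.at-A3 t
  lookup t A4 = Table.at-A4 t
  lookup t B1 = Table.at-B1 t
  lookup t B2 = Table.at-B2 t
  lookup t B3 = Table.at-B3 t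
  lookup t B4 = Table.at-B4 t
  lookup t B5 = Table.at-B5 t
  lookup t C2 = Table.at-C2 t
  lookup t C3 = Table.at-C3 t
  lookup t C4 = Table.at-C4 t
  lookup t C5 = Table.at-C5 t

  tabulate : (∀ p → F p) → Table F
  tabulate f = table (f P0) (f A1) (f A2) (f A3) (f A4) (f B1) (f B2) (f B3) (f B4) (f B5) (f C2) (f C3) (f C4) (f C5)

private variable Q : ℕ → Profile → Set

Level : (ℕ → Profile → Set) → ℕ → Set
Level Q n = Table (Q n)

Window : (ℕ → Profile → Set) → ℕ → Set
Window Q n = Level Q (n ∸ 1) × Level Q (n ∸ 2) × Level Q (n ∸ 3) × Level Q (n ∸ 4) × Level Q (n ∸ 5)

After : (ℕ → Profile → Set) → ℕ → Successor → Set
After Q n σ = Q (n ∸ proj₂ σ) (proj₁ σ)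

Recurrent : (ℕ → Profile → Set) → ℕ → Set
Recurrent Q n = ∀ p → After Q n (skip p) → After Q n (place p) → Q n p

-- The lag-0 transitions P0 → B1 → B2 → B3 → B4 → B5 and P0 → C5 are resolved first.
fill : {n : ℕ} → Recurrent Q n → Window Q n → Level Q n
fill {Q = Q} {n = n} rec (w₁ , w₂ , w₃ , w₄ , w₅) =
  table (rec P0 b1 c5) (rec A1 (lookup w₁ P0) (lookup w₁ C4)) (rec A2 (lookup w₁ A1) (lookup w₂ C3))
        (rec A3 (lookup w₁ A2) (lookup w₃ C2)) (rec A4 (lookup w₁ A3) (lookup w₄ B5))
        b1 b2 b3 b4 b5
        (rec C2 (lookup w₁ B5) (lookup w₂ A3)) (rec C3 (lookup w₁ C2) (lookup w₃ A2)) (rec C4 (lookup w₁ C3) (lookup w₄ A1)) c5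
  where
  b5 : Q n B5
  b5 = rec B5 (lookup w₁ P0) (lookup w₁ A4)
  b4 : Q n B4
  b4 = rec B4 b5 (lookup w₅ P0)
  b3 : Q n B3
  b3 = rec B3 b4 (lookup w₅ P0)
  b2 : Q n B2
  b2 = rec B2 b3 (lookup w₅ P0)
  b1 : Q n B1
  b1 = rec B1 b2 (lookup w₅ P0)
  c5 : Q n C5
  c5 = rec C5 (lookup w₁ C4) (lookup w₅ P0)

advance : {n : ℕ} → Recurrent Q n → Window Q n → Window Q (suc n)
advance {Q = Q} rec w@(w₁ , w₂ , w₃ , w₄ , _) = fill {Q = Q} rec w , w₁ , w₂ , w₃ , w₄

coeff : List ℤ → Series
coeff [] k = + 0
coeff (c ∷ cs) zero = c
coeff (c ∷ cs) (suc k) = coeff cs k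

infixl 6 _⊕_
_⊕_ : List ℤ → List ℤ → List ℤ
[] ⊕ ds = ds
(c ∷ cs) ⊕ [] = c ∷ cs
(c ∷ cs) ⊕ (d ∷ ds) = c +ℤ d ∷ cs ⊕ ds

coeff-⊕ : ∀ cs ds k → coeff (cs ⊕ ds) k ≡ coeff cs k +ℤ coeff ds k
coeff-⊕ [] ds k = sym (ℤ.+-identityˡ (coeff ds k))
coeff-⊕ (c ∷ cs) [] k = sym (ℤ.+-identityʳ (coeff (c ∷ cs) k))
coeff-⊕ (c ∷ cs) (d ∷ ds) zero = refl
coeff-⊕ (c ∷ cs) (d ∷ ds) (suc k) = coeff-⊕ cs ds k

shiftₗ : ℕ → List ℤ → List ℤ
shiftₗ zero cs = cs
shiftₗ (suc b) cs = + 0 ∷ shiftₗ b cs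

coeff-shiftₗ : ∀ b cs k → coeff (shiftₗ b cs) k ≡ shift b (coeff cs) k
coeff-shiftₗ zero cs k = refl
coeff-shiftₗ (suc b) cs zero = refl
coeff-shiftₗ (suc b) cs (suc k) = coeff-shiftₗ b cs k

gen-zero : ∀ p k → gen p 0 k ≡ coeff (+ 1 ∷ []) k
gen-zero p k rewrite rowsFrom-empty 0 (deficits p) with k
... | zero = refl
... | suc k = refl

Expansion : ℕ → Profile → Set
Expansion n p = Σ[ cs ∈ List ℤ ] (∀ k → gen p n k ≡ coeff cs k)

expansion-step : ∀ m → Recurrent Expansion (suc m)
expansion-step m p (cs , gen≡cs) (ds , gen≡ds) = cs ⊕ shiftₗ 1 ds , λ k → begin
  gen p (suc m) k                                                              ≡⟨ gen-suc p m k ⟩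
  genAfter (skip p) (suc m) k +ℤ shift 1 (genAfter (place p) (suc m)) k        ≡⟨ cong₂ _+ℤ_ (gen≡cs k) (shift1-cong k) ⟩
  coeff cs k +ℤ coeff (shiftₗ 1 ds) k                                          ≡⟨ coeff-⊕ cs (shiftₗ 1 ds) k ⟨
  coeff (cs ⊕ shiftₗ 1 ds) k                                                   ∎
  where
  open ≡-Reasoning
  shift1-cong : ∀ k → shift 1 (genAfter (place p) (suc m)) k ≡ coeff (shiftₗ 1 ds) k
  shift1-cong zero = refl
  shift1-cong (suc k) = gen≡ds k

expansion-window : ∀ m → Window Expansion (suc m)
expansion-window zero = initial , initial , initial , initial , initial
  where
  initial : Level Expansion 0
  initial = tabulate λ p → + 1 ∷ [] , gen-zero p
expansion-window (suc m) = advance {Q = Expansion} (expansion-step m) (expansion-window m)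

expansion : ∀ n p → Expansion n p
expansion n = lookup (proj₁ (expansion-window n))

genList : Profile → ℕ → List ℤ
genList p n = proj₁ (expansion n p)

-- The denominator annihilates the profile series

-- applyPoly L g n is the zⁿ-coefficient of poly L · Σₙ g n zⁿ only when n ≥ α for every
-- monomial c zᵅ tᵝ of L: otherwise truncated subtraction reads g 0 in place of a zero.
applyPoly : List Monomial → (ℕ → Series) → ℕ → Series
applyPoly [] g n k = + 0
applyPoly ((c , α , β) ∷ L) g n k = c *ℤ shift β (g (n ∸ α)) k +ℤ applyPoly L g n k

applyPoly-cong : ∀ L {g h : ℕ → Series} {n n′} → (∀ α k → g (n ∸ α) k ≡ h (n′ ∸ α) k) →
  ∀ k → applyPoly L g n k ≡ applyPoly L h n′ k
applyPoly-cong [] g≗h k = refl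
applyPoly-cong ((c , α , β) ∷ L) g≗h k = cong₂ _+ℤ_ (cong (c *ℤ_) (shift-cong β (g≗h α) k)) (applyPoly-cong L g≗h k)

applyPoly-lag : ∀ L (g : ℕ → Series) n l k → applyPoly L (λ m → g (m ∸ l)) n k ≡ applyPoly L g (n ∸ l) k
applyPoly-lag L g n l = applyPoly-cong L (λ α k → cong (λ m → g m k) (∸-swap α))
  where
  ∸-swap : ∀ α → n ∸ α ∸ l ≡ n ∸ l ∸ α
  ∸-swap α = trans (ℕ.∸-+-assoc n α l) (trans (cong (n ∸_) (ℕ.+-comm α l)) (sym (ℕ.∸-+-assoc n l α)))

applyPoly-recurrence : ∀ L (f g h : ℕ → Series) n → True (all (λ { (_ , α , _) → α <ᵇ n }) L) →
  (∀ m k → f (suc m) k ≡ g (suc m) k +ℤ shift 1 (h (suc m)) k) →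
  ∀ k → applyPoly L f n k ≡ applyPoly L g n k +ℤ shift 1 (applyPoly L h n) k
applyPoly-recurrence [] f g h n _ rec zero = refl
applyPoly-recurrence [] f g h n _ rec (suc k) = refl
applyPoly-recurrence ((c , α , β) ∷ L) f g h n below rec k = begin
  c *ℤ shift β (f (n ∸ α)) k +ℤ applyPoly L f n k
    ≡⟨ cong₂ _+ℤ_ (term (n ∸ α) refl) (applyPoly-recurrence L f g h n (proj₂ below′) rec k) ⟩
  (c *ℤ shift β (g (n ∸ α)) k +ℤ shift 1 hᵅ k) +ℤ (applyPoly L g n k +ℤ shift 1 (applyPoly L h n) k)
    ≡⟨ +ℤ-interchange (c *ℤ shift β (g (n ∸ α)) k) (shift 1 hᵅ k) (applyPoly L g n k) (shift 1 (applyPoly L h n) k) ⟩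
  (c *ℤ shift β (g (n ∸ α)) k +ℤ applyPoly L g n k) +ℤ (shift 1 hᵅ k +ℤ shift 1 (applyPoly L h n) k)
    ≡⟨ cong (c *ℤ shift β (g (n ∸ α)) k +ℤ applyPoly L g n k +ℤ_) (shift-+ 1 hᵅ (applyPoly L h n) k) ⟨
  (c *ℤ shift β (g (n ∸ α)) k +ℤ applyPoly L g n k) +ℤ shift 1 (λ i → hᵅ i +ℤ applyPoly L h n i) k ∎
  where
  open ≡-Reasoning
  below′ : True (α <ᵇ n) × True (all (λ { (_ , α , _) → α <ᵇ n }) L)
  below′ = Equivalence.to 𝔹.T-∧ below
  hᵅ : Series
  hᵅ i = c *ℤ shift β (h (n ∸ α)) i
  term : ∀ N → n ∸ α ≡ N → c *ℤ shift β (f N) k ≡ c *ℤ shift β (g N) k +ℤ shift 1 (λ i → c *ℤ shift β (h N) i) k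
  term zero n∸α≡0 = contradiction (subst (0 <_) n∸α≡0 (ℕ.m<n⇒0<n∸m (ℕ.<ᵇ⇒< α n (proj₁ below′)))) λ ()
  term (suc m) _ = begin
    c *ℤ shift β (f (suc m)) k                                                    ≡⟨ cong (c *ℤ_) (shift-cong β (rec m) k) ⟩
    c *ℤ shift β (λ i → g (suc m) i +ℤ shift 1 (h (suc m)) i) k                  ≡⟨ cong (c *ℤ_) (shift-+ β (g (suc m)) _ k) ⟩
    c *ℤ (shift β (g (suc m)) k +ℤ shift β (shift 1 (h (suc m))) k)              ≡⟨ ℤ.*-distribˡ-+ c _ _ ⟩
    c *ℤ shift β (g (suc m)) k +ℤ c *ℤ shift β (shift 1 (h (suc m))) k
      ≡⟨ cong (λ x → c *ℤ shift β (g (suc m)) k +ℤ c *ℤ x) (shift-shift₁ β (h (suc m)) k) ⟩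
    c *ℤ shift β (g (suc m)) k +ℤ c *ℤ shift 1 (shift β (h (suc m))) k
      ≡⟨ cong (c *ℤ shift β (g (suc m)) k +ℤ_) (shift-* 1 c (shift β (h (suc m))) k) ⟨
    c *ℤ shift β (g (suc m)) k +ℤ shift 1 (λ i → c *ℤ shift β (h (suc m)) i) k   ∎

coeff-scale : ∀ c cs k → coeff (map (c *ℤ_) cs) k ≡ c *ℤ coeff cs k
coeff-scale c [] k = sym (ℤ.*-zeroʳ c)
coeff-scale c (d ∷ cs) zero = refl
coeff-scale c (d ∷ cs) (suc k) = coeff-scale c cs k

applyPolyₗ : List Monomial → (ℕ → List ℤ) → ℕ → List ℤ
applyPolyₗ [] cs n = []
applyPolyₗ ((c , α , β) ∷ L) cs n = map (c *ℤ_) (shiftₗ β (cs (n ∸ α))) ⊕ applyPolyₗ L cs n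

coeff-applyPolyₗ : ∀ L {g : ℕ → Series} {cs : ℕ → List ℤ} n → (∀ m k → g m k ≡ coeff (cs m) k) →
  ∀ k → applyPoly L g n k ≡ coeff (applyPolyₗ L cs n) k
coeff-applyPolyₗ [] n g≗cs k = refl
coeff-applyPolyₗ ((c , α , β) ∷ L) {g} {cs} n g≗cs k = begin
  c *ℤ shift β (g (n ∸ α)) k +ℤ applyPoly L g n k
    ≡⟨ cong₂ _+ℤ_ (cong (c *ℤ_) (shift-cong β (g≗cs (n ∸ α)) k)) (coeff-applyPolyₗ L n g≗cs k) ⟩
  c *ℤ shift β (coeff (cs (n ∸ α))) k +ℤ coeff (applyPolyₗ L cs n) k
    ≡⟨ cong (λ x → c *ℤ x +ℤ coeff (applyPolyₗ L cs n) k) (coeff-shiftₗ β (cs (n ∸ α)) k) ⟨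
  c *ℤ coeff (shiftₗ β (cs (n ∸ α))) k +ℤ coeff (applyPolyₗ L cs n) k
    ≡⟨ cong (_+ℤ coeff (applyPolyₗ L cs n) k) (coeff-scale c (shiftₗ β (cs (n ∸ α))) k) ⟨
  coeff (map (c *ℤ_) (shiftₗ β (cs (n ∸ α)))) k +ℤ coeff (applyPolyₗ L cs n) k
    ≡⟨ coeff-⊕ (map (c *ℤ_) (shiftₗ β (cs (n ∸ α)))) (applyPolyₗ L cs n) k ⟨
  coeff (applyPolyₗ ((c , α , β) ∷ L) cs n) k ∎
  where open ≡-Reasoning

isZeroₗ : List ℤ → Bool
isZeroₗ = all (λ c → isYes (c ℤ.≟ + 0))

isZeroₗ-sound : ∀ cs → True (isZeroₗ cs) → ∀ k → coeff cs k ≡ + 0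
isZeroₗ-sound [] _ k = refl
isZeroₗ-sound (c ∷ cs) zero-cs k with Equivalence.to (𝔹.T-∧ {isYes (c ℤ.≟ + 0)}) zero-cs
isZeroₗ-sound (c ∷ cs) zero-cs zero | c≡0 , _ = toWitness {a? = c ℤ.≟ + 0} c≡0
isZeroₗ-sound (c ∷ cs) zero-cs (suc k) | _ , zero-cs′ = isZeroₗ-sound cs zero-cs′ k

Vanishes : ℕ → Profile → Set
Vanishes n p = ∀ k → applyPoly denom (gen p) n k ≡ + 0

vanishesᵇ : ℕ → Profile → Bool
vanishesᵇ n p = isZeroₗ (applyPolyₗ denom (genList p) n)

vanishes-sound : ∀ n p → True (vanishesᵇ n p) → Vanishes n p
vanishes-sound n p checked k =
  trans (coeff-applyPolyₗ denom {cs = genList p} n (λ m → proj₂ (expansion m p)) k)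
        (isZeroₗ-sound (applyPolyₗ denom (genList p) n) checked k)

initialChecks : ∀ p →
  True (vanishesᵇ 20 p) × True (vanishesᵇ 19 p) × True (vanishesᵇ 18 p) × True (vanishesᵇ 17 p) × True (vanishesᵇ 16 p)
initialChecks P0 = _
initialChecks A1 = _
initialChecks A2 = _
initialChecks A3 = _
initialChecks A4 = _
initialChecks B1 = _
initialChecks B2 = _
initialChecks B3 = _
initialChecks B4 = _
initialChecks B5 = _
initialChecks C2 = _
initialChecks C3 = _
initialChecks C4 = _
initialChecks C5 = _

vanishing-step : ∀ r → Recurrent Vanishes (21 + r)
vanishing-step r p skip-vanishes place-vanishes k = begin
  applyPoly denom (gen p) N k
    ≡⟨ applyPoly-recurrence denom (gen p) (genAfter (skip p)) (genAfter (place p)) N _ (gen-suc p) k ⟩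
  applyPoly denom (genAfter (skip p)) N k +ℤ shift 1 (applyPoly denom (genAfter (place p)) N) k
    ≡⟨ cong₂ _+ℤ_ (lagged (skip p) skip-vanishes k) (shift-cong 1 (lagged (place p) place-vanishes) k) ⟩
  + 0 +ℤ shift 1 (λ _ → + 0) k
    ≡⟨ shift-zero k ⟩
  + 0 ∎
  where
  open ≡-Reasoning
  N : ℕ
  N = 21 + r
  lagged : ∀ σ → After Vanishes N σ → ∀ k → applyPoly denom (genAfter σ) N k ≡ + 0
  lagged (q , l) q-vanishes k = trans (applyPoly-lag denom (gen q) N l k) (q-vanishes k)
  shift-zero : ∀ k → + 0 +ℤ shift 1 (λ _ → + 0) k ≡ + 0
  shift-zero zero = refl
  shift-zero (suc k) = refl

initialWindow : Window Vanishes 21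
initialWindow =
  tabulate (λ p → vanishes-sound 20 p (proj₁ (initialChecks p))) ,
  tabulate (λ p → vanishes-sound 19 p (proj₁ (proj₂ (initialChecks p)))) ,
  tabulate (λ p → vanishes-sound 18 p (proj₁ (proj₂ (proj₂ (initialChecks p))))) ,
  tabulate (λ p → vanishes-sound 17 p (proj₁ (proj₂ (proj₂ (proj₂ (initialChecks p)))))) ,
  tabulate (λ p → vanishes-sound 16 p (proj₂ (proj₂ (proj₂ (proj₂ (initialChecks p))))))

vanishing-window : ∀ r → Window Vanishes (21 + r)
vanishing-window zero = initialWindow
vanishing-window (suc r) = advance {Q = Vanishes} (vanishing-step r) (vanishing-window r)

vanishing : ∀ r p → Vanishes (16 + r) p
vanishing r = lookup (proj₂ (proj₂ (proj₂ (proj₂ (vanishing-window r)))))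

-- Cauchy products with polynomials

genT≡gen : ∀ m k → genT 10 5 m k ≡ gen P0 (m ∸ 4) k
genT≡gen m k = cong (λ L → + packings 5 L k) (placements-rows 10 m 5)

sumTo-cong : ∀ m {f g : ℕ → ℤ} → (∀ i → f i ≡ g i) → sumTo m f ≡ sumTo m g
sumTo-cong zero f≗g = f≗g 0
sumTo-cong (suc m) f≗g = cong₂ _+ℤ_ (sumTo-cong m f≗g) (f≗g (suc m))

sumTo-+ : ∀ m (f g : ℕ → ℤ) → sumTo m (λ i → f i +ℤ g i) ≡ sumTo m f +ℤ sumTo m g
sumTo-+ zero f g = refl
sumTo-+ (suc m) f g = trans (cong (_+ℤ (f (suc m) +ℤ g (suc m))) (sumTo-+ m f g))
                            (+ℤ-interchange (sumTo m f) (sumTo m g) (f (suc m)) (g (suc m)))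

sumTo-zero : ∀ m {f : ℕ → ℤ} → (∀ i → f i ≡ + 0) → sumTo m f ≡ + 0
sumTo-zero zero f≗0 = f≗0 0
sumTo-zero (suc m) f≗0 = cong₂ _+ℤ_ (sumTo-zero m f≗0) (f≗0 (suc m))

sumTo-suc : ∀ m (f : ℕ → ℤ) → sumTo (suc m) f ≡ f 0 +ℤ sumTo m (f ∘ suc)
sumTo-suc zero f = refl
sumTo-suc (suc m) f = trans (cong (_+ℤ f (suc (suc m))) (sumTo-suc m f)) (ℤ.+-assoc (f 0) (sumTo m (f ∘ suc)) (f (suc (suc m))))

≤ᵇ-suc : ∀ a m → (suc a ≤ᵇ suc m) ≡ (a ≤ᵇ m)
≤ᵇ-suc zero m = refl
≤ᵇ-suc (suc a) m = refl

sumTo-delta : ∀ a m (h : ℕ → ℤ) → sumTo m (λ i → if a ≡ᵇ i then h i else + 0) ≡ (if a ≤ᵇ m then h a else + 0)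
sumTo-delta zero zero h = refl
sumTo-delta zero (suc m) h = trans (sumTo-suc m _) (trans (cong (h 0 +ℤ_) (sumTo-zero m (λ _ → refl))) (ℤ.+-identityʳ (h 0)))
sumTo-delta (suc a) zero h = refl
sumTo-delta (suc a) (suc m) h = begin
  sumTo (suc m) (λ i → if suc a ≡ᵇ i then h i else + 0)        ≡⟨ sumTo-suc m _ ⟩
  + 0 +ℤ sumTo m (λ i → if a ≡ᵇ i then h (suc i) else + 0)      ≡⟨ ℤ.+-identityˡ _ ⟩
  sumTo m (λ i → if a ≡ᵇ i then h (suc i) else + 0)             ≡⟨ sumTo-delta a m (h ∘ suc) ⟩
  (if a ≤ᵇ m then h (suc a) else + 0)                           ≡⟨ cong (if_then h (suc a) else + 0) (≤ᵇ-suc a m) ⟨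
  (if suc a ≤ᵇ suc m then h (suc a) else + 0)                   ∎
  where open ≡-Reasoning

shift-if : ∀ b (f : Series) k → shift b f k ≡ (if b ≤ᵇ k then f (k ∸ b) else + 0)
shift-if zero f k = refl
shift-if (suc b) f zero = refl
shift-if (suc b) f (suc k) = trans (shift-if b f k) (cong (if_then f (k ∸ b) else + 0) (sym (≤ᵇ-suc b k)))

*-if : ∀ c b x → c *ℤ (if b then x else + 0) ≡ (if b then c *ℤ x else + 0)
*-if c true x = refl
*-if c false x = ℤ.*-zeroʳ c

monomial : ℤ → ℕ → ℕ → FPS₂
monomial c α β i j = if (α ≡ᵇ i) ∧ (β ≡ᵇ j) then c else + 0

monomial-⋆ : ∀ c α β (g : FPS₂) m k → (monomial c α β ⋆ g) m k ≡ (if α ≤ᵇ m then c *ℤ shift β (g (m ∸ α)) k else + 0)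
monomial-⋆ c α β g m k =
  trans (sumTo-cong m (λ i → row-sum i (α ≡ᵇ i))) (sumTo-delta α m (λ i → c *ℤ shift β (g (m ∸ i)) k))
  where
  row-sum : ∀ i b → sumTo k (λ j → (if b ∧ (β ≡ᵇ j) then c else + 0) *ℤ g (m ∸ i) (k ∸ j))
                    ≡ (if b then c *ℤ shift β (g (m ∸ i)) k else + 0)
  row-sum i false = sumTo-zero k (λ j → refl)
  row-sum i true = begin
    sumTo k (λ j → (if β ≡ᵇ j then c else + 0) *ℤ g (m ∸ i) (k ∸ j))
      ≡⟨ sumTo-cong k (λ j → if-* (β ≡ᵇ j) (g (m ∸ i) (k ∸ j))) ⟩
    sumTo k (λ j → if β ≡ᵇ j then c *ℤ g (m ∸ i) (k ∸ j) else + 0)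
      ≡⟨ sumTo-delta β k (λ j → c *ℤ g (m ∸ i) (k ∸ j)) ⟩
    (if β ≤ᵇ k then c *ℤ g (m ∸ i) (k ∸ β) else + 0)
      ≡⟨ *-if c (β ≤ᵇ k) _ ⟨
    c *ℤ (if β ≤ᵇ k then g (m ∸ i) (k ∸ β) else + 0)
      ≡⟨ cong (c *ℤ_) (shift-if β (g (m ∸ i)) k) ⟨
    c *ℤ shift β (g (m ∸ i)) k ∎
    where
    open ≡-Reasoning
    if-* : ∀ b x → (if b then c else + 0) *ℤ x ≡ (if b then c *ℤ x else + 0)
    if-* true x = refl
    if-* false x = refl

degreeAtMost : ℕ → Monomial → Bool
degreeAtMost m (_ , α , _) = α ≤ᵇ m

lowerTerms : ℕ → List Monomial → List Monomial
lowerTerms m = filterᵇ (degreeAtMost m)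

⋆-applyPoly : ∀ L g m k → (poly L ⋆ g) m k ≡ applyPoly (lowerTerms m L) g m k
⋆-applyPoly [] g m k = sumTo-zero m (λ i → sumTo-zero k (λ j → refl))
⋆-applyPoly ((c , α , β) ∷ L) g m k = begin
  sumTo m (λ i → sumTo k (λ j → (monomial c α β i j +ℤ poly L i j) *ℤ g (m ∸ i) (k ∸ j)))
    ≡⟨ sumTo-cong m (λ i → trans (sumTo-cong k (λ j → ℤ.*-distribʳ-+ (g (m ∸ i) (k ∸ j)) (monomial c α β i j) (poly L i j)))
                                 (sumTo-+ k _ _)) ⟩
  sumTo m (λ i → sumTo k (λ j → monomial c α β i j *ℤ g (m ∸ i) (k ∸ j)) +ℤ sumTo k (λ j → poly L i j *ℤ g (m ∸ i) (k ∸ j)))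
    ≡⟨ sumTo-+ m _ _ ⟩
  (monomial c α β ⋆ g) m k +ℤ (poly L ⋆ g) m k
    ≡⟨ cong₂ _+ℤ_ (monomial-⋆ c α β g m k) (⋆-applyPoly L g m k) ⟩
  (if α ≤ᵇ m then c *ℤ shift β (g (m ∸ α)) k else + 0) +ℤ applyPoly (lowerTerms m L) g m k
    ≡⟨ by-degree (α ≤ᵇ m) refl ⟩
  applyPoly (lowerTerms m ((c , α , β) ∷ L)) g m k ∎
  where
  open ≡-Reasoning
  by-degree : ∀ b → (α ≤ᵇ m) ≡ b →
      (if b then c *ℤ shift β (g (m ∸ α)) k else + 0) +ℤ applyPoly (lowerTerms m L) g m k
    ≡ applyPoly (lowerTerms m ((c , α , β) ∷ L)) g m k
  by-degree true α≤m =
    cong (λ L′ → applyPoly L′ g m k) (sym (List.filter-accept (T? ∘ degreeAtMost m) {x = c , α , β} {xs = L} (subst True (sym α≤m) _)))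
  by-degree false α≰m =
    trans (ℤ.+-identityˡ (applyPoly (lowerTerms m L) g m k))
          (cong (λ L′ → applyPoly L′ g m k) (sym (List.filter-reject (T? ∘ degreeAtMost m) {x = c , α , β} {xs = L} (subst True α≰m))))

polyₗ : List Monomial → ℕ → List ℤ
polyₗ [] m = []
polyₗ ((c , α , β) ∷ L) m = (if α ≡ᵇ m then shiftₗ β (c ∷ []) else []) ⊕ polyₗ L m

coeff-polyₗ : ∀ L m k → poly L m k ≡ coeff (polyₗ L m) k
coeff-polyₗ [] m k = refl
coeff-polyₗ ((c , α , β) ∷ L) m k =
  trans (cong₂ _+ℤ_ (by-degree (α ≡ᵇ m)) (coeff-polyₗ L m k))
        (sym (coeff-⊕ (if α ≡ᵇ m then shiftₗ β (c ∷ []) else []) (polyₗ L m) k))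
  where
  point : ∀ β k → (if β ≡ᵇ k then c else + 0) ≡ coeff (shiftₗ β (c ∷ [])) k
  point zero zero = refl
  point zero (suc k) = refl
  point (suc β) zero = refl
  point (suc β) (suc k) = point β k
  by-degree : ∀ b → (if b ∧ (β ≡ᵇ k) then c else + 0) ≡ coeff (if b then shiftₗ β (c ∷ []) else []) k
  by-degree false = refl
  by-degree true = point β k

coeff-neg : ∀ cs k → coeff (map -_ cs) k ≡ - coeff cs k
coeff-neg [] k = refl
coeff-neg (c ∷ cs) zero = refl
coeff-neg (c ∷ cs) (suc k) = coeff-neg cs k

genT-coeff : ∀ m k → genT 10 5 m k ≡ coeff (genList P0 (m ∸ 4)) k
genT-coeff m k = trans (genT≡gen m k) (proj₂ (expansion (m ∸ 4) P0) k)

Agrees : ℕ → Set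
Agrees m = ∀ k → (poly denom ⋆ genT 10 5) m k ≡ poly numer m k

agreesᵇ : ℕ → Bool
agreesᵇ m = isZeroₗ (applyPolyₗ (lowerTerms m denom) (λ n → genList P0 (n ∸ 4)) m ⊕ map -_ (polyₗ numer m))

agrees-sound : ∀ m → True (agreesᵇ m) → Agrees m
agrees-sound m checked k = ℤ.i-j≡0⇒i≡j ((poly denom ⋆ genT 10 5) m k) (poly numer m k) (begin
  (poly denom ⋆ genT 10 5) m k -ℤ poly numer m k
    ≡⟨ cong₂ _-ℤ_ (trans (⋆-applyPoly denom (genT 10 5) m k)
                         (coeff-applyPolyₗ (lowerTerms m denom) {cs = λ n → genList P0 (n ∸ 4)} m genT-coeff k))
                  (coeff-polyₗ numer m k) ⟩
  coeff lhs k -ℤ coeff rhs k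
    ≡⟨ cong (coeff lhs k +ℤ_) (coeff-neg rhs k) ⟨
  coeff lhs k +ℤ coeff (map -_ rhs) k
    ≡⟨ coeff-⊕ lhs (map -_ rhs) k ⟨
  coeff (lhs ⊕ map -_ rhs) k
    ≡⟨ isZeroₗ-sound (lhs ⊕ map -_ rhs) checked k ⟩
  + 0 ∎)
  where
  open ≡-Reasoning
  lhs rhs : List ℤ
  lhs = applyPolyₗ (lowerTerms m denom) (λ n → genList P0 (n ∸ 4)) m
  rhs = polyₗ numer m

agrees-below-20 : ∀ m → m < 20 → Agrees m
agrees-below-20 m m<20 = agrees-sound m (All.lookup (all⁺ agreesᵇ (upTo 20) checked) (∈-upTo⁺ m<20))
  where
  checked : True (all agreesᵇ (upTo 20))
  checked = _

-- From length 20 on no numerator term is left and no lower term of D is cut off.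
agrees-from-20 : ∀ r → Agrees (20 + r)
agrees-from-20 r k = begin
  (poly denom ⋆ genT 10 5) (20 + r) k                ≡⟨ ⋆-applyPoly denom (genT 10 5) (20 + r) k ⟩
  applyPoly denom (genT 10 5) (20 + r) k
    ≡⟨ applyPoly-cong denom {g = genT 10 5} {h = λ n → gen P0 (n ∸ 4)} {n = 20 + r} (λ α → genT≡gen (20 + r ∸ α)) k ⟩
  applyPoly denom (λ n → gen P0 (n ∸ 4)) (20 + r) k  ≡⟨ applyPoly-lag denom (gen P0) (20 + r) 4 k ⟩
  applyPoly denom (gen P0) (16 + r) k                ≡⟨ vanishing r P0 k ⟩
  + 0                                                ∎
  where open ≡-Reasoning

mainTheorem12 : (m k : ℕ) → (poly denom ⋆ genT 10 5) m k ≡ poly numer m k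
mainTheorem12 m with m ℕ.<? 20
... | yes m<20 = agrees-below-20 m m<20
... | no m≮20 = subst Agrees (ℕ.m+[n∸m]≡n (ℕ.≮⇒≥ m≮20)) (agrees-from-20 (m ∸ 20))
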